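{- Let $m\ge1$ and $k\ge1$ be integers and $N\ge0$. Suppose that for every finite graph $G$ and all disjoint $A,B\subseteq V(G)$, either $G$ contains $k$ pairwise edge-disjoint $A$-$B$-paths of length at least $m+1$ or there is a set of at most $N$ edges of $G$ meeting all $A$-$B$-paths of length at least $m+1$. Then for every finite graph $G$ and all disjoint $A,B\subseteq V(G)$, either $G$ contains $k$ pairwise edge-disjoint $A^*$-$B$-paths of length at least $m$ or there is a set of at most $N$ edges of $G$ meeting all $A^*$-$B$-paths of length at least $m$.
   Context: An $A$-$B$-path is a path $P=x_0\dots x_n$ with $V(P)\cap A=\{x_0\}$ and $V(P)\cap B=\{x_n\}$. An $A^*$-$B$-path is a path starting at a vertex of $A$ and ending at a vertex of $B$ such that no other vertex of the path lies in $B$ (vertices of $A$ may occur in its interior). The length of a path is its number of edges. -}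

module Defs where

open import Data.Nat using (ℕ; zero; suc; _≤_)
open import Data.Fin using (Fin; zero; suc; inject₁; fromℕ)
open import Data.Fin.Subset using (Subset; _∈_; _∉_)
open import Data.Bool using (Bool; true; false)
open import Data.Product using (Σ; ∃; ∃-syntax; _×_; _,_)
open import Data.Sum using (_⊎_)
open import Data.List using (List; length)
open import Data.List.Membership.Propositional as L using ()
open import Data.List.Relation.Unary.All using (All)
open import Relation.Binary.PropositionalEquality using (_≡_; _≢_)
open import Relation.Nullary using (¬_)
open import Function.Definitions using (Injective)

record Graph : Set where
  field
    n     : ℕ
    adj   : Fin n → Fin n → Bool
    sym   : ∀ u v → adj u v ≡ adj v u
    irrefl : ∀ v → adj v v ≡ false

open Graph public

V : Graph → Set
V G = Fin (n G)

Adj : (G : Graph) → V G → V G → Set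
Adj G u v = adj G u v ≡ true

-- Two ordered vertex pairs represent the same unordered edge.
SameEdge : {X : Set} → X × X → X × X → Set
SameEdge (a , b) (c , d) = (a ≡ c × b ≡ d) ⊎ (a ≡ d × b ≡ c)

record Path (G : Graph) : Set where
  field
    len    : ℕ
    vert   : Fin (suc len) → V G
    inj    : Injective _≡_ _≡_ vert
    adjacent : ∀ (i : Fin len) → Adj G (vert (inject₁ i)) (vert (suc i))

open Path public

edgeOf : {G : Graph} (P : Path G) → Fin (len P) → V G × V G
edgeOf P i = vert P (inject₁ i) , vert P (suc i)

first last : {G : Graph} (P : Path G) → V G
first P = vert P zero
last  P = vert P (fromℕ (len P))

Disjoint : {n : ℕ} → Subset n → Subset n → Set
Disjoint A B = ∀ v → v ∈ A → v ∉ B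

IsABPath : (G : Graph) → Subset (n G) → Subset (n G) → Path G → Set
IsABPath G A B P =
  first P ∈ A × last P ∈ B ×
  (∀ i → vert P i ∈ A → i ≡ zero) ×
  (∀ i → vert P i ∈ B → i ≡ fromℕ (len P))

IsA*BPath : (G : Graph) → Subset (n G) → Subset (n G) → Path G → Set
IsA*BPath G A B P =
  first P ∈ A × last P ∈ B ×
  (∀ i → vert P i ∈ B → i ≡ fromℕ (len P))

EdgeDisjoint : {G : Graph} → Path G → Path G → Set
EdgeDisjoint P Q = ∀ i j → ¬ SameEdge (edgeOf P i) (edgeOf Q j)

HasEdgeDisjoint : (G : Graph) → (Path G → Set) → ℕ → Set
HasEdgeDisjoint G Good k =
  Σ (Fin k → Path G) λ Ps →
    (∀ i → Good (Ps i)) × (∀ i j → i ≢ j → EdgeDisjoint (Ps i) (Ps j))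

Meets : {G : Graph} → List (V G × V G) → Path G → Set
Meets F P = ∃[ i ] ∃[ e ] (e L.∈ F × SameEdge e (edgeOf P i))

HasEdgeCover : (G : Graph) → (Path G → Set) → ℕ → Set
HasEdgeCover G Good N =
  Σ (List (V G × V G)) λ F →
    length F ≤ N ×
    All (λ e → Adj G (Data.Product.proj₁ e) (Data.Product.proj₂ e)) F ×
    (∀ P → Good P → Meets F P)

LongABPath : (G : Graph) → Subset (n G) → Subset (n G) → ℕ → Path G → Set
LongABPath G A B ℓ P = IsABPath G A B P × ℓ ≤ len P

LongA*BPath : (G : Graph) → Subset (n G) → Subset (n G) → ℕ → Path G → Set
LongA*BPath G A B ℓ P = IsA*BPath G A B P × ℓ ≤ len P

-- Hang 2N+1 pendant copies of every vertex of G onto it, let A⁺ be the pendant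
-- copies of the vertices of A and B⁺ the vertices of B in the original copy.
-- A pendant vertex has a single neighbour, so an A⁺-B⁺-path consists of one
-- pendant edge followed by an A*-B-path of G, and dropping its first edge is a
-- length-decreasing projection that preserves edge-disjointness. Conversely, a
-- set of at most N edges of the extended graph touches at most 2N pendant
-- layers; lifting every A*-B-path through a fresh layer shows that the
-- original-copy edges of such a set meet all long A*-B-paths.
module Submission where

open import Defs hiding (sym)
open import Data.Nat using (ℕ; suc; _≤_; zero; _+_; _*_; _<_; s≤s)
import Data.Nat.Properties as ℕ
open import Data.Fin using (Fin; zero; suc; inject₁; fromℕ; combine; remQuot)
import Data.Fin.Properties as Fin
open import Data.Fin.Subset using (Subset)
import Data.Fin.Subset as Subset
open import Data.Bool using (Bool; true; false)
open import Data.Maybe using (Maybe; just; nothing)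
import Data.Maybe.Relation.Unary.All as Maybe
import Data.Maybe.Relation.Unary.Any as Maybe
open import Data.Product as Product using (Σ; ∃; ∃₂; _×_; _,_; proj₁; proj₂; uncurry)
open import Data.Sum as Sum using (_⊎_; inj₁; inj₂)
open import Data.Empty using (⊥; ⊥-elim)
open import Data.List as List using (List; _∷_; length; map; mapMaybe; _++_)
import Data.List.Properties as List
open import Data.List.Membership.Propositional using (_∈_; _∉_)
open import Data.List.Membership.Propositional.Properties using (∈-map⁺; ∈-++⁺ˡ; ∈-++⁺ʳ)
open import Data.List.Relation.Unary.All as All using (All)
import Data.List.Relation.Unary.All.Properties as All
import Data.List.Relation.Unary.Any as Any
import Data.List.Relation.Unary.Any.Properties as Any
open import Data.Vec using (tabulate; lookup)
open import Data.Vec.Properties using (lookup∘tabulate; []=⇒lookup; lookup⇒[]=)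
open import Relation.Binary.PropositionalEquality
  using (_≡_; _≢_; ≢-sym; refl; sym; trans; cong; cong₂; subst; subst₂; module ≡-Reasoning)
open import Relation.Nullary using (¬_; does; yes; no)
open import Relation.Nullary.Decidable using (dec-true; dec-false)

fromℕ-or-inject₁ : ∀ {n} (i : Fin (suc n)) → i ≡ fromℕ n ⊎ ∃ λ j → i ≡ inject₁ j
fromℕ-or-inject₁ {zero}  zero    = inj₁ refl
fromℕ-or-inject₁ {suc n} zero    = inj₂ (zero , refl)
fromℕ-or-inject₁ {suc n} (suc i) =
  Sum.map (cong suc) (Product.map suc (cong suc)) (fromℕ-or-inject₁ i)

inject₁²≢suc² : ∀ {n} (j : Fin n) → inject₁ (inject₁ j) ≢ suc (suc j)
inject₁²≢suc² (suc j) e = inject₁²≢suc² j (Fin.suc-injective e)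

∈-tabulate⁺ : ∀ {n} {f : Fin n → Bool} {x} → f x ≡ true → x Subset.∈ tabulate f
∈-tabulate⁺ {f = f} {x} fx = lookup⇒[]= x _ (trans (lookup∘tabulate f x) fx)

∈-tabulate⁻ : ∀ {n} {f : Fin n → Bool} {x} → x Subset.∈ tabulate f → f x ≡ true
∈-tabulate⁻ {f = f} {x} x∈ = trans (sym (lookup∘tabulate f x)) ([]=⇒lookup x∈)

∃∉ : ∀ {n} (xs : List (Fin n)) → length xs < n → ∃ λ i → i ∉ xs
∃∉ {n} xs |xs|<n = Fin.¬∀⟶∃¬ n (_∈ xs) (_∈? xs) all∉
  where
  open import Data.List.Membership.DecPropositional (Fin._≟_ {n}) using (_∈?_)
  all∉ : ¬ (∀ i → i ∈ xs)
  all∉ all∈ with Fin.pigeonhole |xs|<n (λ i → Any.index (all∈ i))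
  ... | i , j , i<j , same = Fin.<⇒≢ i<j (begin
    i                                   ≡⟨ Any.lookup-index (all∈ i) ⟩
    List.lookup xs (Any.index (all∈ i)) ≡⟨ cong (List.lookup xs) same ⟩
    List.lookup xs (Any.index (all∈ j)) ≡⟨ sym (Any.lookup-index (all∈ j)) ⟩
    j                                   ∎)
    where open ≡-Reasoning

does-≟-sym : ∀ {n} (a b : Fin n) → does (a Fin.≟ b) ≡ does (b Fin.≟ a)
does-≟-sym a b with a Fin.≟ b
... | yes refl = sym (dec-true (a Fin.≟ a) refl)
... | no a≢b   = sym (dec-false (b Fin.≟ a) (≢-sym a≢b))

does-≟⇒≡ : ∀ {n} (a b : Fin n) → does (a Fin.≟ b) ≡ true → a ≡ b
does-≟⇒≡ a b e with a Fin.≟ b | e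
... | yes a≡b | _ = a≡b
... | no _    | ()

SameEdge-map : {X Y : Set} (f : X → Y) {e e′ : X × X} →
               SameEdge e e′ → SameEdge (Product.map f f e) (Product.map f f e′)
SameEdge-map f (inj₁ (refl , refl)) = inj₁ (refl , refl)
SameEdge-map f (inj₂ (refl , refl)) = inj₂ (refl , refl)

-- Layer zero is a copy of G; in every layer suc t each vertex a of G has a
-- pendant copy (a , suc t) whose only neighbour is (a , zero).
module PendantExtension (G : Graph) (s : ℕ) where

  Point : Set
  Point = V G × Fin (suc s)

  pendantAdj : Point → Point → Bool
  pendantAdj (a , zero)  (b , zero)  = adj G a b
  pendantAdj (a , zero)  (b , suc _) = does (a Fin.≟ b)
  pendantAdj (a , suc _) (b , zero)  = does (a Fin.≟ b)
  pendantAdj (a , suc _) (b , suc _) = false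

  pendantAdj-sym : ∀ p q → pendantAdj p q ≡ pendantAdj q p
  pendantAdj-sym (a , zero)  (b , zero)  = Graph.sym G a b
  pendantAdj-sym (a , zero)  (b , suc _) = does-≟-sym a b
  pendantAdj-sym (a , suc _) (b , zero)  = does-≟-sym a b
  pendantAdj-sym (a , suc _) (b , suc _) = refl

  pendantAdj-irrefl : ∀ p → pendantAdj p p ≡ false
  pendantAdj-irrefl (a , zero)  = irrefl G a
  pendantAdj-irrefl (a , suc _) = refl

  point : Fin (n G * suc s) → Point
  point = remQuot (suc s)

  G⁺ : Graph
  G⁺ = record
    { n      = n G * suc s
    ; adj    = λ x y → pendantAdj (point x) (point y)
    ; sym    = λ x y → pendantAdj-sym (point x) (point y)
    ; irrefl = λ x → pendantAdj-irrefl (point x)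
    }

  vertex : Point → V G⁺
  vertex = uncurry combine

  point-vertex : ∀ p → point (vertex p) ≡ p
  point-vertex (a , t) = Fin.remQuot-combine a t

  point-injective : ∀ {x y} → point x ≡ point y → x ≡ y
  point-injective {x} {y} e = begin
    x                    ≡⟨ sym (Fin.combine-remQuot {n G} (suc s) x) ⟩
    vertex (point x)     ≡⟨ cong vertex e ⟩
    vertex (point y)     ≡⟨ Fin.combine-remQuot {n G} (suc s) y ⟩
    y                    ∎
    where open ≡-Reasoning

  base : V G → V G⁺
  base a = vertex (a , zero)

  pendant : V G → Fin s → V G⁺
  pendant a t = vertex (a , suc t)

  ≡base : ∀ {x a} → point x ≡ (a , zero) → x ≡ base a
  ≡base e = point-injective (trans e (sym (point-vertex _)))

  vertex-injective : ∀ {p q} → vertex p ≡ vertex q → p ≡ q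
  vertex-injective e = trans (sym (point-vertex _)) (trans (cong point e) (point-vertex _))

  base-injective : ∀ {a b} → base a ≡ base b → a ≡ b
  base-injective e = cong proj₁ (vertex-injective e)

  pendant≢base : ∀ {a t b} → pendant a t ≢ base b
  pendant≢base e with vertex-injective e
  ... | ()

  Adj-base⁺ : ∀ {a b} → Adj G a b → Adj G⁺ (base a) (base b)
  Adj-base⁺ = subst₂ (λ p q → pendantAdj p q ≡ true)
    (sym (point-vertex _)) (sym (point-vertex _))

  Adj-base⁻ : ∀ {a b} → Adj G⁺ (base a) (base b) → Adj G a b
  Adj-base⁻ = subst₂ (λ p q → pendantAdj p q ≡ true) (point-vertex _) (point-vertex _)

  Adj-pendant : ∀ a t → Adj G⁺ (pendant a t) (base a)
  Adj-pendant a t = subst₂ (λ p q → pendantAdj p q ≡ true)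
    (sym (point-vertex _)) (sym (point-vertex _)) (dec-true (a Fin.≟ a) refl)

  pendant-neighbour : ∀ {a t} q → pendantAdj (a , suc t) q ≡ true → q ≡ (a , zero)
  pendant-neighbour {a} (b , zero) e = cong (_, zero) (sym (does-≟⇒≡ a b e))
  pendant-neighbour (b , suc _) ()

  pendant-leaf : ∀ {p a t q} → pendantAdj p (a , suc t) ≡ true →
                 pendantAdj (a , suc t) q ≡ true → p ≡ q
  pendant-leaf {p} p~a a~q =
    trans (pendant-neighbour p (trans (pendantAdj-sym (_ , suc _) p) p~a))
          (sym (pendant-neighbour _ a~q))

  pendant-endpoint : (P : Path G⁺) (i : Fin (len P)) {a : V G} {t : Fin s} →
                     point (vert P (suc i)) ≡ (a , suc t) → suc i ≡ fromℕ (len P)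
  pendant-endpoint record { len = zero } () _
  pendant-endpoint P@record { len = suc L } i {a} {t} e with fromℕ-or-inject₁ i
  ... | inj₁ refl       = refl
  ... | inj₂ (j , refl) =
    ⊥-elim (inject₁²≢suc² j (inj P (point-injective (pendant-leaf before after))))
    where
    previous next : Point
    previous = point (vert P (inject₁ (inject₁ j)))
    next     = point (vert P (suc (suc j)))
    before : pendantAdj previous (a , suc t) ≡ true
    before = subst (λ q → pendantAdj previous q ≡ true) e (adjacent P (inject₁ j))
    after : pendantAdj (a , suc t) next ≡ true
    after = subst (λ p → pendantAdj p next ≡ true) e (adjacent P (suc j))

  site : V G⁺ → V G
  site x = proj₁ (point x)

  layer : V G⁺ → Fin (suc s)
  layer x = proj₂ (point x)

  layer-pendant : ∀ {a t} → layer (pendant a t) ≡ suc t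
  layer-pendant = cong proj₂ (point-vertex _)

  vertex∈⁺ : ∀ {f : Point → Bool} {p} → f p ≡ true →
             vertex p Subset.∈ tabulate (λ x → f (point x))
  vertex∈⁺ {f} fp = ∈-tabulate⁺ (subst (λ q → f q ≡ true) (sym (point-vertex _)) fp)

  vertex∈⁻ : ∀ {f : Point → Bool} {p} →
             vertex p Subset.∈ tabulate (λ x → f (point x)) → f p ≡ true
  vertex∈⁻ {f} p∈ = subst (λ q → f q ≡ true) (point-vertex _) (∈-tabulate⁻ p∈)

  lifted : Fin s → (Q : Path G) → Fin (suc (suc (len Q))) → V G⁺
  lifted t Q zero    = pendant (first Q) t
  lifted t Q (suc i) = base (vert Q i)

  lifted-injective : ∀ t Q {i j} → lifted t Q i ≡ lifted t Q j → i ≡ j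
  lifted-injective t Q {zero}  {zero}  _ = refl
  lifted-injective t Q {zero}  {suc j} e = ⊥-elim (pendant≢base e)
  lifted-injective t Q {suc i} {zero}  e = ⊥-elim (pendant≢base (sym e))
  lifted-injective t Q {suc i} {suc j} e = cong suc (inj Q (base-injective e))

  lifted-adjacent : ∀ t Q (i : Fin (suc (len Q))) →
                    Adj G⁺ (lifted t Q (inject₁ i)) (lifted t Q (suc i))
  lifted-adjacent t Q zero    = Adj-pendant (first Q) t
  lifted-adjacent t Q (suc i) = Adj-base⁺ (adjacent Q i)

  lift : Fin s → Path G → Path G⁺
  lift t Q = record
    { len      = suc (len Q)
    ; vert     = lifted t Q
    ; inj      = lifted-injective t Q
    ; adjacent = lifted-adjacent t Q
    }

  LiftsEdges : Path G⁺ → Path G → Set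
  LiftsEdges P Q = ∀ i → ∃ λ j → edgeOf P j ≡ Product.map base base (edgeOf Q i)

  EdgeDisjoint-unlift : ∀ {P P′ Q Q′} → EdgeDisjoint P P′ →
                        LiftsEdges P Q → LiftsEdges P′ Q′ → EdgeDisjoint Q Q′
  EdgeDisjoint-unlift disjoint lifts lifts′ i j same with lifts i | lifts′ j
  ... | i′ , e | j′ , e′ =
    disjoint i′ j′ (subst₂ SameEdge (sym e) (sym e′) (SameEdge-map base same))

  baseEdgeᵖ : Point → Point → Maybe (V G × V G)
  baseEdgeᵖ (a , zero)  (b , zero)  = just (a , b)
  baseEdgeᵖ (a , zero)  (b , suc _) = nothing
  baseEdgeᵖ (a , suc _) (b , _)     = nothing

  baseEdge : V G⁺ × V G⁺ → Maybe (V G × V G)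
  baseEdge (x , y) = baseEdgeᵖ (point x) (point y)

  baseEdge-base : ∀ a b → baseEdge (base a , base b) ≡ just (a , b)
  baseEdge-base a b = cong₂ baseEdgeᵖ (point-vertex _) (point-vertex _)

  AdjPair : (H : Graph) → V H × V H → Set
  AdjPair H (x , y) = Adj H x y

  baseEdgeᵖ-Adj : ∀ p q → pendantAdj p q ≡ true → Maybe.All (AdjPair G) (baseEdgeᵖ p q)
  baseEdgeᵖ-Adj (a , zero)  (b , zero)  a~b = Maybe.just a~b
  baseEdgeᵖ-Adj (a , zero)  (b , suc _) _   = Maybe.nothing
  baseEdgeᵖ-Adj (a , suc _) (b , _)     _   = Maybe.nothing

  baseEdges : List (V G⁺ × V G⁺) → List (V G × V G)
  baseEdges = mapMaybe baseEdge

  baseEdges-Adj : ∀ F → All (AdjPair G⁺) F → All (AdjPair G) (baseEdges F)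
  baseEdges-Adj F F-adj =
    All.mapMaybe⁺ (All.map⁺ (All.map
      (λ {e} → baseEdgeᵖ-Adj (point (proj₁ e)) (point (proj₂ e))) F-adj))

  ∈-baseEdges : ∀ {F e e′} → e ∈ F → baseEdge e ≡ just e′ → e′ ∈ baseEdges F
  ∈-baseEdges {F} {e′ = e′} e∈F e↦e′ =
    Any.mapMaybe⁺ baseEdge F (Any.map⁺ (Any.map (λ { refl → just-∈ }) e∈F))
    where
    just-∈ : Maybe.Any (e′ ≡_) (baseEdge _)
    just-∈ = subst (Maybe.Any (e′ ≡_)) (sym e↦e′) (Maybe.just refl)

  layers : List (V G⁺ × V G⁺) → List (Fin (suc s))
  layers F = map (λ e → layer (proj₁ e)) F ++ map (λ e → layer (proj₂ e)) F

  length-layers : ∀ F → length (layers F) ≡ length F + length F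
  length-layers F = begin
    length (layers F)
      ≡⟨ List.length-++ (map (λ e → layer (proj₁ e)) F) ⟩
    length (map _ F) + length (map _ F)
      ≡⟨ cong₂ _+_ (List.length-map _ F) (List.length-map _ F) ⟩
    length F + length F ∎
    where open ≡-Reasoning

  ∈-layers : ∀ {F e} → e ∈ F → layer (proj₁ e) ∈ layers F × layer (proj₂ e) ∈ layers F
  ∈-layers e∈F = ∈-++⁺ˡ (∈-map⁺ (λ e → layer (proj₁ e)) e∈F) ,
                 ∈-++⁺ʳ _ (∈-map⁺ (λ e → layer (proj₂ e)) e∈F)

  fresh-layer : ∀ F → length F + length F < s → ∃ λ t → suc t ∉ layers F
  fresh-layer F bound
    with ∃∉ (zero ∷ layers F) (s≤s (subst (_< s) (sym (length-layers F)) bound))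
  ... | zero  , ∉ = ⊥-elim (∉ (Any.here refl))
  ... | suc t , ∉ = t , λ t∈ → ∉ (Any.there t∈)

  module Terminals (A B : Subset (n G)) where

    inA⁺ inB⁺ : Point → Bool
    inA⁺ (a , zero)  = false
    inA⁺ (a , suc _) = lookup A a
    inB⁺ (b , zero)  = lookup B b
    inB⁺ (b , suc _) = false

    A⁺ B⁺ : Subset (n G⁺)
    A⁺ = tabulate (λ x → inA⁺ (point x))
    B⁺ = tabulate (λ x → inB⁺ (point x))

    disjoint⁺ : Disjoint A⁺ B⁺
    disjoint⁺ x x∈A⁺ x∈B⁺ = exclusive (point x) (∈-tabulate⁻ x∈A⁺) (∈-tabulate⁻ x∈B⁺)
      where
      exclusive : ∀ p → inA⁺ p ≡ true → inB⁺ p ≡ true → ⊥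
      exclusive (a , zero)  () _
      exclusive (a , suc _) _  ()

    inA⁺-pendant : ∀ p → inA⁺ p ≡ true → ∃₂ λ a t → p ≡ (a , suc t) × a Subset.∈ A
    inA⁺-pendant (a , suc t) a∈A = a , t , refl , lookup⇒[]= a A a∈A

    inB⁺-site : ∀ p → inB⁺ p ≡ true → proj₁ p Subset.∈ B
    inB⁺-site (b , zero) b∈B = lookup⇒[]= b B b∈B

    base∈B⁺ : ∀ {b} → b Subset.∈ B → base b Subset.∈ B⁺
    base∈B⁺ b∈B = vertex∈⁺ {f = inB⁺} ([]=⇒lookup b∈B)

    on-base-after-first : (P : Path G⁺) → last P Subset.∈ B⁺ →
                          ∀ i → vert P (suc i) ≡ base (site (vert P (suc i)))
    on-base-after-first P last∈B⁺ i = ≡base (layer-zero (point (vert P (suc i))) refl)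
      where
      -- a pendant vertex after the first would be the last one, which lies in B⁺
      layer-zero : ∀ p → point (vert P (suc i)) ≡ p → p ≡ (proj₁ p , zero)
      layer-zero (a , zero)  _ = refl
      layer-zero (a , suc t) e with ∈-tabulate⁻ {f = λ x → inB⁺ (point x)}
        (subst (λ j → vert P j Subset.∈ B⁺) (sym (pendant-endpoint P i e)) last∈B⁺)
      ... | last∈ with () ← trans (cong inB⁺ (sym e)) last∈

    project : ∀ {ℓ} (P : Path G⁺) → LongABPath G⁺ A⁺ B⁺ (suc ℓ) P →
              Σ (Path G) λ Q → LongA*BPath G A B ℓ Q × LiftsEdges P Q
    project record { len = zero } (_ , ())
    project P@record { len = suc L } ((first∈A⁺ , last∈B⁺ , _ , only-last∈B⁺) , s≤s ℓ≤L) =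
      Q , ((first∈A , last∈B , only-last∈B) , ℓ≤L) , lifts
      where
      onBase : ∀ i → vert P (suc i) ≡ base (site (vert P (suc i)))
      onBase = on-base-after-first P last∈B⁺

      Q : Path G
      Q = record
        { len      = L
        ; vert     = λ i → site (vert P (suc i))
        ; inj      = λ e → Fin.suc-injective
                             (inj P (trans (onBase _) (trans (cong base e) (sym (onBase _)))))
        ; adjacent = λ i → Adj-base⁻
                             (subst₂ (Adj G⁺) (onBase _) (onBase _) (adjacent P (suc i)))
        }

      first∈A : first Q Subset.∈ A
      first∈A with inA⁺-pendant (point (first P)) (∈-tabulate⁻ first∈A⁺)
      ... | a , t , e , a∈A = subst (Subset._∈ A) (sym (cong proj₁ second≡)) a∈A
        where
        second≡ : point (vert P (suc zero)) ≡ (a , zero)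
        second≡ = pendant-neighbour _
          (subst (λ p → pendantAdj p (point (vert P (suc zero))) ≡ true) e (adjacent P zero))

      last∈B : last Q Subset.∈ B
      last∈B = inB⁺-site (point (last P)) (∈-tabulate⁻ last∈B⁺)

      only-last∈B : ∀ i → vert Q i Subset.∈ B → i ≡ fromℕ L
      only-last∈B i q∈B = Fin.suc-injective
        (only-last∈B⁺ (suc i) (subst (Subset._∈ B⁺) (sym (onBase i)) (base∈B⁺ q∈B)))

      lifts : LiftsEdges P Q
      lifts i = suc i , cong₂ _,_ (onBase (inject₁ i)) (onBase (suc i))

    lift-long : ∀ {ℓ} t {Q} → LongA*BPath G A B ℓ Q → LongABPath G⁺ A⁺ B⁺ (suc ℓ) (lift t Q)
    lift-long t {Q} ((first∈A , last∈B , only-last∈B) , ℓ≤len) =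
      ( vertex∈⁺ {f = inA⁺} ([]=⇒lookup first∈A) , base∈B⁺ last∈B
      , only-first∈A⁺ , only-last∈B⁺ ) ,
      s≤s ℓ≤len
      where
      only-first∈A⁺ : ∀ i → lifted t Q i Subset.∈ A⁺ → i ≡ zero
      only-first∈A⁺ zero    _ = refl
      only-first∈A⁺ (suc i) q∈A⁺ with () ← vertex∈⁻ {f = inA⁺} q∈A⁺
      only-last∈B⁺ : ∀ i → lifted t Q i Subset.∈ B⁺ → i ≡ fromℕ (len (lift t Q))
      only-last∈B⁺ zero    p∈B⁺ with () ← vertex∈⁻ {f = inB⁺} p∈B⁺
      only-last∈B⁺ (suc i) q∈B⁺ =
        cong suc (only-last∈B i (inB⁺-site _ (vertex∈⁻ {f = inB⁺} q∈B⁺)))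

    edgeDisjoint-projection : ∀ {ℓ k} → HasEdgeDisjoint G⁺ (LongABPath G⁺ A⁺ B⁺ (suc ℓ)) k →
                              HasEdgeDisjoint G (LongA*BPath G A B ℓ) k
    edgeDisjoint-projection {ℓ} {k} (Ps , long , disjoint) = Qs , Qs-long , Qs-disjoint
      where
      Qs : Fin k → Path G
      Qs i = proj₁ (project (Ps i) (long i))
      Qs-long : ∀ i → LongA*BPath G A B ℓ (Qs i)
      Qs-long i = proj₁ (proj₂ (project (Ps i) (long i)))
      Qs-disjoint : ∀ i j → i ≢ j → EdgeDisjoint (Qs i) (Qs j)
      Qs-disjoint i j i≢j = EdgeDisjoint-unlift {Ps i} {Ps j} {Qs i} {Qs j} (disjoint i j i≢j)
        (proj₂ (proj₂ (project (Ps i) (long i)))) (proj₂ (proj₂ (project (Ps j) (long j))))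

    edgeCover-projection : ∀ {ℓ N} → N + N < s →
                           HasEdgeCover G⁺ (LongABPath G⁺ A⁺ B⁺ (suc ℓ)) N →
                           HasEdgeCover G (LongA*BPath G A B ℓ) N
    edgeCover-projection {ℓ} 2N<s (F , |F|≤N , F-adj , meets)
      with fresh-layer F (ℕ.≤-<-trans (ℕ.+-mono-≤ |F|≤N |F|≤N) 2N<s)
    ... | t , t∉ =
      baseEdges F , ℕ.≤-trans (List.length-mapMaybe baseEdge F) |F|≤N ,
      baseEdges-Adj F F-adj , covers
      where
      not-pendant : ∀ {x a} → layer x ∈ layers F → x ≢ pendant a t
      not-pendant x∈ refl = t∉ (subst (_∈ layers F) layer-pendant x∈)

      covers : ∀ Q → LongA*BPath G A B ℓ Q → Meets (baseEdges F) Q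
      covers Q long with meets (lift t Q) (lift-long t long)
      ... | zero , e , e∈F , inj₁ (e₁≡ , _) = ⊥-elim (not-pendant (proj₁ (∈-layers e∈F)) e₁≡)
      ... | zero , e , e∈F , inj₂ (_ , e₂≡) = ⊥-elim (not-pendant (proj₂ (∈-layers e∈F)) e₂≡)
      ... | suc j , e , e∈F , inj₁ (refl , refl) =
        j , _ , ∈-baseEdges e∈F (baseEdge-base _ _) , inj₁ (refl , refl)
      ... | suc j , e , e∈F , inj₂ (refl , refl) =
        j , _ , ∈-baseEdges e∈F (baseEdge-base _ _) , inj₂ (refl , refl)

mainTheorem6 : (m k N : ℕ) → 1 ≤ m → 1 ≤ k →
    ((G : Graph) (A B : Subset (n G)) → Disjoint A B →
      HasEdgeDisjoint G (LongABPath G A B (suc m)) k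
        ⊎ HasEdgeCover G (LongABPath G A B (suc m)) N) →
    (G : Graph) (A B : Subset (n G)) → Disjoint A B →
      HasEdgeDisjoint G (LongA*BPath G A B m) k
        ⊎ HasEdgeCover G (LongA*BPath G A B m) N
mainTheorem6 m k N _ _ hypothesis G A B _ =
  Sum.map edgeDisjoint-projection (edgeCover-projection (ℕ.n<1+n (N + N)))
    (hypothesis G⁺ A⁺ B⁺ disjoint⁺)
  where
  open PendantExtension G (suc (N + N))
  open Terminals A B
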